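{- Let $e\ge0$ be an integer and let $(x_n)_{n\ge1}$ be an infinite normal tower sequence for $f(x,y)=y^3+y+x^{2^e}$ (as defined in the context). Let $n>1$ and let $p$ be a prime divisor of $|\mathrm{GF}(2^{2\cdot3^{n-1}})^*|$. If $x_{n-1}$ is not a $p$-th power in the multiplicative group $\mathrm{GF}(2^{2\cdot3^{n-1}})^*$, then for every $j\ge n$, $x_j$ is not a $p$-th power in the multiplicative group $\mathrm{GF}(2^{2\cdot3^{j}})^*$.
   Context: $\mathrm{GF}(2^m)$ denotes the field with $2^m$ elements, inside a fixed algebraic closure. An infinite normal tower sequence for $f(x,y)=y^3+y+x^{2^e}$ is a sequence $(x_n)_{n\ge1}$ with $x_1\in\mathrm{GF}(2^6)$ such that, for every $n\ge2$, the polynomial $f(x_{n-1},y)\in\mathrm{GF}(2^{2\cdot3^{n-1}})[y]$ is irreducible over $\mathrm{GF}(2^{2\cdot3^{n-1}})$ and $x_n$ is one of its roots; then $x_n\in\mathrm{GF}(2^{2\cdot3^{n}})\setminus\mathrm{GF}(2^{2\cdot3^{n-1}})$. -}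

module Defs where

open import Level using (Level; _⊔_)
open import Algebra.Bundles using (CommutativeRing)
open import Data.Nat as ℕ using (ℕ; zero; suc; _∸_; _≤_)
open import Data.List using (List; []; _∷_; map)
open import Data.List.Relation.Unary.All using (All)
open import Data.Product using (_×_; ∃)
open import Data.Sum using (_⊎_)
open import Relation.Nullary using (¬_)

module _ {c ℓ : Level} (K : CommutativeRing c ℓ) where
  open CommutativeRing K

  IsField : Set (c ⊔ ℓ)
  IsField = (¬ (1# ≈ 0#)) × (∀ x → ¬ (x ≈ 0#) → ∃ λ y → x * y ≈ 1#)

  Char2 : Set ℓ
  Char2 = 1# + 1# ≈ 0#

  pow : Carrier → ℕ → Carrier
  pow x zero    = 1#
  pow x (suc n) = x * pow x n

  -- polynomials in one variable over K: coefficient lists, lowest degree first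
  Poly : Set c
  Poly = List Carrier

  coeff : Poly → ℕ → Carrier
  coeff []       _       = 0#
  coeff (a ∷ _)  zero    = a
  coeff (_ ∷ as) (suc i) = coeff as i

  -- equality of polynomials (coefficientwise, trailing zeros irrelevant)
  _≈P_ : Poly → Poly → Set ℓ
  p ≈P q = ∀ i → coeff p i ≈ coeff q i

  _+P_ : Poly → Poly → Poly
  []       +P q        = q
  (a ∷ p)  +P []       = a ∷ p
  (a ∷ p)  +P (b ∷ q)  = (a + b) ∷ (p +P q)

  _*P_ : Poly → Poly → Poly
  []      *P q = []
  (a ∷ p) *P q = map (a *_) q +P (0# ∷ (p *P q))

  eval : Poly → Carrier → Carrier
  eval []       _ = 0#
  eval (a ∷ as) x = a + x * eval as x

  IsConstant : Poly → Set ℓ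
  IsConstant p = ∀ i → coeff p (suc i) ≈ 0#

  AlgClosed : Set (c ⊔ ℓ)
  AlgClosed = ∀ p → ¬ IsConstant p → ∃ λ x → eval p x ≈ 0#

  -- membership in GF(2^m) ⊆ K: the roots of X^(2^m) - X
  InGF : ℕ → Carrier → Set ℓ
  InGF m x = pow x (2 ℕ.^ m) ≈ x

  CoeffsIn : ℕ → Poly → Set (c ⊔ ℓ)
  CoeffsIn m p = All (InGF m) p

  -- g is irreducible in GF(2^m)[y] (units of GF(2^m)[y] = nonzero constants)
  IrreducibleOver : ℕ → Poly → Set (c ⊔ ℓ)
  IrreducibleOver m g =
    CoeffsIn m g × (¬ IsConstant g) ×
    (∀ a b → CoeffsIn m a → CoeffsIn m b → g ≈P (a *P b) → IsConstant a ⊎ IsConstant b)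

  -- f(x, y) = y^3 + y + x^(2^e), as a polynomial in y
  fpoly : ℕ → Carrier → Poly
  fpoly e x = pow x (2 ℕ.^ e) ∷ 1# ∷ 0# ∷ 1# ∷ []

  -- infinite normal tower sequence (x_n)_{n ≥ 1}; the value at index 0 is unused
  NormalTower : ℕ → (ℕ → Carrier) → Set (c ⊔ ℓ)
  NormalTower e x =
    InGF 6 (x 1) ×
    (∀ n → 2 ≤ n →
       IrreducibleOver (2 ℕ.* 3 ℕ.^ (n ∸ 1)) (fpoly e (x (n ∸ 1))) ×
       eval (fpoly e (x (n ∸ 1))) (x n) ≈ 0#)

  IsPthPowerIn : ℕ → ℕ → Carrier → Set (c ⊔ ℓ)
  IsPthPowerIn m p x = ∃ λ y → InGF m y × (¬ (y ≈ 0#)) × pow y p ≈ x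

-- Let q = 2^m with m = 2·3^k. If x_{k+1} = y^p with y ∈ GF(q³)^*, apply the norm
-- N z = z · z^q · z^(q²) of GF(q³)/GF(q): it is multiplicative, so N x_{k+1} = (N y)^p.
-- Since x_{k+1} is a root of y³ + y + x_k^(2^e), which is irreducible over GF(q), its
-- conjugates x_{k+1}, x_{k+1}^q, x_{k+1}^(q²) are the three distinct roots, so their product
-- N x_{k+1} is the constant term x_k^(2^e). Hence x_k^(2^e) is a p-th power in GF(q)^*, and
-- as the Frobenius map is bijective on GF(q), so is x_k. Contrapositively, not being a p-th
-- power propagates up the tower.
module Submission where

open import Defs
open import Level using (Level; _⊔_)
open import Algebra.Bundles using (CommutativeRing)
open import Data.Nat as ℕ using (ℕ; zero; suc; s≤s; _≤′_; ≤′-refl; ≤′-step)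
import Data.Nat.Properties as ℕ
open import Algebra.Properties.CommutativeSemigroup ℕ.*-commutativeSemigroup using (x∙yz≈y∙xz)
open import Data.Product using (_,_; proj₁; proj₂)
open import Data.Sum using (inj₁; inj₂)
open import Data.List using ([]; _∷_)
open import Data.List.Relation.Unary.All using ([]; _∷_)
open import Function using (id; _∘_)
open import Relation.Nullary using (¬_)
open import Relation.Binary.PropositionalEquality as ≡ using (_≡_)

module CharacteristicTwo {c ℓ : Level} (K : CommutativeRing c ℓ) (char2 : Char2 K) where

  open CommutativeRing K
  open import Algebra.Properties.CommutativeSemiring.Exp commutativeSemiring public
  open import Algebra.Properties.Monoid.Mult *-monoid using (×-idem)
  open import Algebra.Solver.Ring.NaturalCoefficients.Default commutativeSemiring
    using (solve; _:=_; _:+_; _:*_)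
  open import Relation.Binary.Reasoning.Setoid setoid

  x+x≈0 : ∀ x → x + x ≈ 0#
  x+x≈0 x = begin
    x + x               ≈⟨ +-cong (*-identityˡ x) (*-identityˡ x) ⟨
    1# * x + 1# * x     ≈⟨ distribʳ x 1# 1# ⟨
    (1# + 1#) * x       ≈⟨ *-congʳ char2 ⟩
    0# * x              ≈⟨ zeroˡ x ⟩
    0#                  ∎

  x+y≈0⇒x≈y : ∀ {x y} → x + y ≈ 0# → x ≈ y
  x+y≈0⇒x≈y {x} {y} x+y≈0 = begin
    x                   ≈⟨ +-identityʳ x ⟨
    x + 0#              ≈⟨ +-congˡ (x+x≈0 y) ⟨
    x + (y + y)         ≈⟨ +-assoc x y y ⟨
    (x + y) + y         ≈⟨ +-congʳ x+y≈0 ⟩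
    0# + y              ≈⟨ +-identityˡ y ⟩
    y                   ∎

  x≈y⇒x+y≈0 : ∀ {x y} → x ≈ y → x + y ≈ 0#
  x≈y⇒x+y≈0 {y = y} x≈y = trans (+-congʳ x≈y) (x+x≈0 y)

  -- Lets the ring solver, which knows nothing of characteristic 2, prove identities up to doubled terms.
  cancel-doubles : ∀ {u v} w w′ → u + (w + w) ≈ v + (w′ + w′) → u ≈ v
  cancel-doubles {u} {v} w w′ eq = begin
    u                   ≈⟨ +-identityʳ u ⟨
    u + 0#              ≈⟨ +-congˡ (x+x≈0 w) ⟨
    u + (w + w)         ≈⟨ eq ⟩
    v + (w′ + w′)       ≈⟨ +-congˡ (x+x≈0 w′) ⟩
    v + 0#              ≈⟨ +-identityʳ v ⟩
    v                   ∎

  square-+ : ∀ x y → (x + y) * (x + y) ≈ x * x + y * y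
  square-+ x y = begin
    (x + y) * (x + y)                   ≈⟨ solve 2 (λ x y → (x :+ y) :* (x :+ y) :=
                                             (x :* x :+ y :* y) :+ (x :* y :+ x :* y)) refl x y ⟩
    (x * x + y * y) + (x * y + x * y)   ≈⟨ +-congˡ (x+x≈0 (x * y)) ⟩
    (x * x + y * y) + 0#                ≈⟨ +-identityʳ _ ⟩
    x * x + y * y                       ∎

  pow≈^ : ∀ x n → pow K x n ≈ x ^ n
  pow≈^ x zero    = refl
  pow≈^ x (suc n) = *-congˡ (pow≈^ x n)

  frobenius : ℕ → Carrier → Carrier
  frobenius m x = x ^ (2 ℕ.^ m)

  InGF⇒frobenius-fixed : ∀ m {x} → InGF K m x → frobenius m x ≈ x
  InGF⇒frobenius-fixed m {x} = trans (sym (pow≈^ x (2 ℕ.^ m)))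

  frobenius-fixed⇒InGF : ∀ m {x} → frobenius m x ≈ x → InGF K m x
  frobenius-fixed⇒InGF m {x} = trans (pow≈^ x (2 ℕ.^ m))

  frobenius-cong : ∀ m {x y} → x ≈ y → frobenius m x ≈ frobenius m y
  frobenius-cong m = ^-congˡ (2 ℕ.^ m)

  frobenius-zero : ∀ x → frobenius 0 x ≈ x
  frobenius-zero = *-identityʳ

  frobenius-+ℕ : ∀ m n x → frobenius (m ℕ.+ n) x ≈ frobenius n (frobenius m x)
  frobenius-+ℕ m n x = begin
    x ^ (2 ℕ.^ (m ℕ.+ n))           ≡⟨ ≡.cong (x ^_) (ℕ.^-distribˡ-+-* 2 m n) ⟩
    x ^ (2 ℕ.^ m ℕ.* 2 ℕ.^ n)       ≈⟨ ^-assocʳ x (2 ℕ.^ m) (2 ℕ.^ n) ⟨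
    (x ^ (2 ℕ.^ m)) ^ (2 ℕ.^ n)     ∎

  frobenius-comm : ∀ m n x → frobenius m (frobenius n x) ≈ frobenius n (frobenius m x)
  frobenius-comm m n x = begin
    frobenius m (frobenius n x)     ≈⟨ frobenius-+ℕ n m x ⟨
    frobenius (n ℕ.+ m) x           ≡⟨ ≡.cong (λ k → frobenius k x) (ℕ.+-comm n m) ⟩
    frobenius (m ℕ.+ n) x           ≈⟨ frobenius-+ℕ m n x ⟩
    frobenius n (frobenius m x)     ∎

  frobenius-suc : ∀ m x → frobenius (suc m) x ≈ frobenius m (x * x)
  frobenius-suc m x = trans (frobenius-+ℕ 1 m x) (frobenius-cong m (*-congˡ (*-identityʳ x)))

  frobenius-+ : ∀ m x y → frobenius m (x + y) ≈ frobenius m x + frobenius m y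
  frobenius-+ zero x y =
    trans (frobenius-zero (x + y)) (sym (+-cong (frobenius-zero x) (frobenius-zero y)))
  frobenius-+ (suc m) x y = begin
    frobenius (suc m) (x + y)                     ≈⟨ frobenius-suc m (x + y) ⟩
    frobenius m ((x + y) * (x + y))               ≈⟨ frobenius-cong m (square-+ x y) ⟩
    frobenius m (x * x + y * y)                   ≈⟨ frobenius-+ m (x * x) (y * y) ⟩
    frobenius m (x * x) + frobenius m (y * y)     ≈⟨ +-cong (frobenius-suc m x) (frobenius-suc m y) ⟨
    frobenius (suc m) x + frobenius (suc m) y     ∎

  frobenius-* : ∀ m x y → frobenius m (x * y) ≈ frobenius m x * frobenius m y
  frobenius-* m x y = ^-distrib-* x y (2 ℕ.^ m)

  frobenius-^ : ∀ m x n → frobenius m (x ^ n) ≈ frobenius m x ^ n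
  frobenius-^ m x n = begin
    (x ^ n) ^ (2 ℕ.^ m)       ≈⟨ ^-assocʳ x n (2 ℕ.^ m) ⟩
    x ^ (n ℕ.* 2 ℕ.^ m)       ≡⟨ ≡.cong (x ^_) (ℕ.*-comm n (2 ℕ.^ m)) ⟩
    x ^ (2 ℕ.^ m ℕ.* n)       ≈⟨ ^-assocʳ x (2 ℕ.^ m) n ⟨
    (x ^ (2 ℕ.^ m)) ^ n       ∎

  frobenius-0# : ∀ m → frobenius m 0# ≈ 0#
  frobenius-0# m = ×-idem (zeroˡ 0#) (2 ℕ.^ m) {{ℕ.m^n≢0 2 m}}

  frobenius-1# : ∀ m → frobenius m 1# ≈ 1#
  frobenius-1# m = ×-idem (*-identityˡ 1#) (2 ℕ.^ m) {{ℕ.m^n≢0 2 m}}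

  eval-frobenius : ∀ m p x → CoeffsIn K m p →
                   frobenius m (eval K p x) ≈ eval K p (frobenius m x)
  eval-frobenius m []       x []         = frobenius-0# m
  eval-frobenius m (a ∷ p) x (a∈ ∷ p∈) = begin
    frobenius m (a + x * eval K p x)
      ≈⟨ trans (frobenius-+ m a _) (+-congˡ (frobenius-* m x _)) ⟩
    frobenius m a + frobenius m x * frobenius m (eval K p x)
      ≈⟨ +-cong (InGF⇒frobenius-fixed m a∈) (*-congˡ (eval-frobenius m p x p∈)) ⟩
    a + frobenius m x * eval K p (frobenius m x)
      ∎

  frobenius-fixed-iterate : ∀ {m x} → frobenius m x ≈ x → ∀ k → frobenius (k ℕ.* m) x ≈ x
  frobenius-fixed-iterate {m} {x} fixed zero    = frobenius-zero x
  frobenius-fixed-iterate {m} {x} fixed (suc k) = begin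
    frobenius (m ℕ.+ k ℕ.* m) x           ≈⟨ frobenius-+ℕ m (k ℕ.* m) x ⟩
    frobenius (k ℕ.* m) (frobenius m x)   ≈⟨ frobenius-cong (k ℕ.* m) fixed ⟩
    frobenius (k ℕ.* m) x                 ≈⟨ frobenius-fixed-iterate fixed k ⟩
    x                                     ∎

  frobenius-3* : ∀ m x → frobenius (3 ℕ.* m) x ≈ frobenius m (frobenius m (frobenius m x))
  frobenius-3* m x = begin
    frobenius (m ℕ.+ (m ℕ.+ (m ℕ.+ 0))) x               ≈⟨ frobenius-+ℕ m _ x ⟩
    frobenius (m ℕ.+ (m ℕ.+ 0)) (frobenius m x)         ≈⟨ frobenius-+ℕ m _ _ ⟩
    frobenius (m ℕ.+ 0) (frobenius m (frobenius m x))   ≈⟨ frobenius-+ℕ m 0 _ ⟩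
    frobenius 0 (frobenius m (frobenius m (frobenius m x)))
                                                        ≈⟨ frobenius-zero _ ⟩
    frobenius m (frobenius m (frobenius m x))           ∎

  norm : ℕ → Carrier → Carrier
  norm m x = x * (frobenius m x * frobenius m (frobenius m x))

  norm-cong : ∀ m {x y} → x ≈ y → norm m x ≈ norm m y
  norm-cong m x≈y = *-cong x≈y (*-cong (frobenius-cong m x≈y) (frobenius-cong m (frobenius-cong m x≈y)))

  norm-fixed : ∀ m {x} → frobenius (3 ℕ.* m) x ≈ x → frobenius m (norm m x) ≈ norm m x
  norm-fixed m {x} fixed = begin
    frobenius m (x * (σ x * σ (σ x)))           ≈⟨ trans (frobenius-* m x _) (*-congˡ (frobenius-* m (σ x) _)) ⟩
    σ x * (σ (σ x) * σ (σ (σ x)))               ≈⟨ *-congˡ (*-congˡ (trans (sym (frobenius-3* m x)) fixed)) ⟩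
    σ x * (σ (σ x) * x)                         ≈⟨ solve 3 (λ x y z → y :* (z :* x) := x :* (y :* z)) refl x (σ x) (σ (σ x)) ⟩
    x * (σ x * σ (σ x))                         ∎
    where
    σ : Carrier → Carrier
    σ = frobenius m

  norm-^ : ∀ m x n → norm m (x ^ n) ≈ norm m x ^ n
  norm-^ m x n = begin
    x ^ n * (σ (x ^ n) * σ (σ (x ^ n)))         ≈⟨ *-congˡ (*-cong (frobenius-^ m x n)
                                                     (trans (frobenius-cong m (frobenius-^ m x n)) (frobenius-^ m (σ x) n))) ⟩
    x ^ n * (σ x ^ n * σ (σ x) ^ n)             ≈⟨ *-congˡ (^-distrib-* (σ x) (σ (σ x)) n) ⟨
    x ^ n * (σ x * σ (σ x)) ^ n                 ≈⟨ ^-distrib-* x _ n ⟨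
    (x * (σ x * σ (σ x))) ^ n                   ∎
    where
    σ : Carrier → Carrier
    σ = frobenius m

module CharacteristicTwoField {c ℓ : Level} (K : CommutativeRing c ℓ)
                              (isField : IsField K) (char2 : Char2 K) where

  open CommutativeRing K
  open CharacteristicTwo K char2
  open import Algebra.Solver.Ring.NaturalCoefficients.Default commutativeSemiring
    using (solve; _:=_; _:+_; _:*_)
  open import Relation.Binary.Reasoning.Setoid setoid

  1≉0 : ¬ 1# ≈ 0#
  1≉0 = proj₁ isField

  x≉0∧xy≈0⇒y≈0 : ∀ {x y} → ¬ x ≈ 0# → x * y ≈ 0# → y ≈ 0#
  x≉0∧xy≈0⇒y≈0 {x} {y} x≉0 xy≈0 with proj₂ isField x x≉0
  ... | x⁻¹ , xx⁻¹≈1 = begin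
    y                 ≈⟨ *-identityˡ y ⟨
    1# * y            ≈⟨ *-congʳ xx⁻¹≈1 ⟨
    (x * x⁻¹) * y     ≈⟨ solve 3 (λ x x⁻¹ y → (x :* x⁻¹) :* y := x⁻¹ :* (x :* y)) refl x x⁻¹ y ⟩
    x⁻¹ * (x * y)     ≈⟨ *-congˡ xy≈0 ⟩
    x⁻¹ * 0#          ≈⟨ zeroʳ x⁻¹ ⟩
    0#                ∎

  x*y≉0 : ∀ {x y} → ¬ x ≈ 0# → ¬ y ≈ 0# → ¬ x * y ≈ 0#
  x*y≉0 x≉0 y≉0 = y≉0 ∘ x≉0∧xy≈0⇒y≈0 x≉0

  x^n≉0 : ∀ {x} n → ¬ x ≈ 0# → ¬ x ^ n ≈ 0#
  x^n≉0 zero    x≉0 = 1≉0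
  x^n≉0 (suc n) x≉0 = x*y≉0 x≉0 (x^n≉0 n x≉0)

  x≉y⇒x+y≉0 : ∀ {x y} → ¬ x ≈ y → ¬ x + y ≈ 0#
  x≉y⇒x+y≉0 x≉y = x≉y ∘ x+y≈0⇒x≈y

  -- Only doubly negated: a field given by inverses of nonzero elements need not decide x + y ≈ 0#.
  square-injective : ∀ {x y} → x * x ≈ y * y → ¬ ¬ x ≈ y
  square-injective {x} {y} xx≈yy x≉y =
    x≉y⇒x+y≉0 x≉y (x≉0∧xy≈0⇒y≈0 (x≉y⇒x+y≉0 x≉y) (trans (square-+ x y) (x≈y⇒x+y≈0 xx≈yy)))

  frobenius-injective : ∀ m {x y} → frobenius m x ≈ frobenius m y → ¬ ¬ x ≈ y
  frobenius-injective zero {x} {y} eq x≉y =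
    x≉y (trans (sym (frobenius-zero x)) (trans eq (frobenius-zero y)))
  frobenius-injective (suc m) {x} {y} eq x≉y =
    frobenius-injective m (trans (sym (frobenius-suc m x)) (trans eq (frobenius-suc m y)))
      (λ xx≈yy → square-injective xx≈yy x≉y)

  depressedCubic : Carrier → Carrier → Poly K
  depressedCubic a b = b ∷ a ∷ 0# ∷ 1# ∷ []

  eval-depressedCubic : ∀ a b z → eval K (depressedCubic a b) z ≈ b + (z * a + z * (z * z))
  eval-depressedCubic a b z = +-congˡ (begin
    z * (a + z * (0# + z * (1# + z * 0#)))    ≈⟨ *-congˡ (+-congˡ (*-congˡ z+0≈z)) ⟩
    z * (a + z * z)                           ≈⟨ distribˡ z a (z * z) ⟩
    z * a + z * (z * z)                       ∎)
    where
    z+0≈z : 0# + z * (1# + z * 0#) ≈ z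
    z+0≈z = trans (+-identityˡ _)
      (trans (*-congˡ (trans (+-congˡ (zeroʳ z)) (+-identityʳ 1#))) (*-identityʳ z))

  depressedCubic-roots-product : ∀ {a b r s t} →
    eval K (depressedCubic a b) r ≈ 0# → eval K (depressedCubic a b) s ≈ 0# →
    eval K (depressedCubic a b) t ≈ 0# →
    ¬ r ≈ s → ¬ r ≈ t → ¬ s ≈ t → r * (s * t) ≈ b
  depressedCubic-roots-product {a} {b} {r} {s} {t} r-root s-root t-root r≉s r≉t s≉t =
    x+y≈0⇒x≈y (begin
      r * (s * t) + b                         ≈⟨ +-identityʳ _ ⟨
      r * (s * t) + b + 0#                    ≈⟨ +-congˡ (trans (*-congˡ (T≈0 s-root r≉s)) (zeroʳ r)) ⟨
      r * (s * t) + b + r * T r s             ≈⟨ solve 5 (λ a b r s t →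
          r :* (s :* t) :+ b :+ r :* (r :* r :+ r :* s :+ s :* s :+ a)
            := r :* s :* (r :+ s :+ t) :+ (b :+ (r :* a :+ r :* (r :* r)))) refl a b r s t ⟩
      r * s * (r + s + t) + f r               ≈⟨ +-cong (trans (*-congˡ r+s+t≈0) (zeroʳ _)) (root r-root) ⟩
      0# + 0#                                 ≈⟨ +-identityʳ 0# ⟩
      0#                                      ∎)
    where
    f : Carrier → Carrier
    f z = b + (z * a + z * (z * z))

    root : ∀ {z} → eval K (depressedCubic a b) z ≈ 0# → f z ≈ 0#
    root {z} = trans (sym (eval-depressedCubic a b z))

    T : Carrier → Carrier → Carrier
    T u v = u * u + u * v + v * v + a

    T≈0 : ∀ {v} → eval K (depressedCubic a b) v ≈ 0# → ¬ r ≈ v → T r v ≈ 0#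
    T≈0 {v} v-root r≉v = x≉0∧xy≈0⇒y≈0 (x≉y⇒x+y≉0 r≉v) (begin
      (r + v) * T r v     ≈⟨ cancel-doubles b (r * (r * v) + r * (v * v)) (solve 4 (λ a b r v →
          (r :+ v) :* (r :* r :+ r :* v :+ v :* v :+ a) :+ (b :+ b)
            := (b :+ (r :* a :+ r :* (r :* r))) :+ (b :+ (v :* a :+ v :* (v :* v)))
               :+ ((r :* (r :* v) :+ r :* (v :* v)) :+ (r :* (r :* v) :+ r :* (v :* v))))
          refl a b r v) ⟩
      f r + f v           ≈⟨ +-cong (root r-root) (root v-root) ⟩
      0# + 0#             ≈⟨ +-identityʳ 0# ⟩
      0#                  ∎)

    r+s+t≈0 : r + s + t ≈ 0#
    r+s+t≈0 = x≉0∧xy≈0⇒y≈0 (x≉y⇒x+y≉0 s≉t) (begin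
      (s + t) * (r + s + t)   ≈⟨ cancel-doubles (r * r + a) (s * t) (solve 4 (λ a r s t →
          (s :+ t) :* (r :+ s :+ t) :+ ((r :* r :+ a) :+ (r :* r :+ a))
            := (r :* r :+ r :* s :+ s :* s :+ a) :+ (r :* r :+ r :* t :+ t :* t :+ a)
               :+ (s :* t :+ s :* t))
          refl a r s t) ⟩
      T r s + T r t           ≈⟨ +-cong (T≈0 s-root r≉s) (T≈0 t-root r≉t) ⟩
      0# + 0#                 ≈⟨ +-identityʳ 0# ⟩
      0#                      ∎)

  depressedCubic-factor : ∀ {a b r} → eval K (depressedCubic a b) r ≈ 0# →
    _≈P_ K (depressedCubic a b) (_*P_ K (r ∷ 1# ∷ []) ((r * r + a) ∷ r ∷ 1# ∷ []))
  depressedCubic-factor {a} {b} {r} root zero = begin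
    b                           ≈⟨ x+y≈0⇒x≈y (trans (sym (eval-depressedCubic a b r)) root) ⟩
    r * a + r * (r * r)         ≈⟨ solve 2 (λ a r → r :* a :+ r :* (r :* r) := r :* (r :* r :+ a)) refl a r ⟩
    r * (r * r + a)             ≈⟨ +-identityʳ _ ⟨
    r * (r * r + a) + 0#        ∎
  depressedCubic-factor {a} {b} {r} root (suc zero) = begin
    a                                 ≈⟨ +-identityˡ a ⟨
    0# + a                            ≈⟨ +-congʳ (x+x≈0 (r * r)) ⟨
    (r * r + r * r) + a               ≈⟨ +-assoc _ _ a ⟩
    r * r + (r * r + a)               ≈⟨ +-congˡ (trans (+-identityʳ _) (*-identityˡ _)) ⟨
    r * r + (1# * (r * r + a) + 0#)   ∎
  depressedCubic-factor {r = r} root (suc (suc zero)) =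
    sym (trans (+-cong (*-identityʳ r) (*-identityˡ r)) (x+x≈0 r))
  depressedCubic-factor root (suc (suc (suc zero))) = sym (*-identityˡ 1#)
  depressedCubic-factor root (suc (suc (suc (suc i)))) = refl

  irreducible-depressedCubic-root∉GF : ∀ m {a b r} → IrreducibleOver K m (depressedCubic a b) →
    eval K (depressedCubic a b) r ≈ 0# → ¬ InGF K m r
  irreducible-depressedCubic-root∉GF m {a} {b} {r} ((_ ∷ a∈ ∷ _) , _ , irreducible) root r∈
    with irreducible (r ∷ 1# ∷ []) ((r * r + a) ∷ r ∷ 1# ∷ [])
                     (r∈ ∷ 1∈ ∷ []) (r*r+a∈ ∷ r∈ ∷ 1∈ ∷ []) (depressedCubic-factor root)
    where
    1∈ : InGF K m 1#
    1∈ = frobenius-fixed⇒InGF m (frobenius-1# m)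
    r*r+a∈ : InGF K m (r * r + a)
    r*r+a∈ = frobenius-fixed⇒InGF m (begin
      frobenius m (r * r + a)                             ≈⟨ frobenius-+ m (r * r) a ⟩
      frobenius m (r * r) + frobenius m a                 ≈⟨ +-congʳ (frobenius-* m r r) ⟩
      frobenius m r * frobenius m r + frobenius m a       ≈⟨ +-cong (*-cong r-fixed r-fixed)
                                                                    (InGF⇒frobenius-fixed m a∈) ⟩
      r * r + a                                           ∎)
      where
      r-fixed : frobenius m r ≈ r
      r-fixed = InGF⇒frobenius-fixed m r∈
  ... | inj₁ linear-constant    = 1≉0 (linear-constant 0)
  ... | inj₂ quadratic-constant = 1≉0 (quadratic-constant 1)

  norm≉0 : ∀ m {x} → ¬ x ≈ 0# → ¬ norm m x ≈ 0#
  norm≉0 m x≉0 = x*y≉0 x≉0 (x*y≉0 (x^n≉0 (2 ℕ.^ m) x≉0) (x^n≉0 (2 ℕ.^ m) (x^n≉0 (2 ℕ.^ m) x≉0)))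

  -- The roots r, σ r, σ² r are distinct because r ∉ GF(2^m) and σ³ r = r.
  norm-of-root : ∀ m {a b r} → IrreducibleOver K m (depressedCubic a b) →
    eval K (depressedCubic a b) r ≈ 0# → frobenius (3 ℕ.* m) r ≈ r → norm m r ≈ b
  norm-of-root m {a} {b} {r} irreducible root fixed =
    depressedCubic-roots-product root (conjugate-root root) (conjugate-root (conjugate-root root))
      r≉σr r≉σσr σr≉σσr
    where
    σ : Carrier → Carrier
    σ = frobenius m

    conjugate-root : ∀ {z} → eval K (depressedCubic a b) z ≈ 0# → eval K (depressedCubic a b) (σ z) ≈ 0#
    conjugate-root {z} z-root = begin
      eval K (depressedCubic a b) (σ z)   ≈⟨ eval-frobenius m (depressedCubic a b) z (proj₁ irreducible) ⟨
      σ (eval K (depressedCubic a b) z)   ≈⟨ frobenius-cong m z-root ⟩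
      σ 0#                                ≈⟨ frobenius-0# m ⟩
      0#                                  ∎

    r≉σr : ¬ r ≈ σ r
    r≉σr r≈σr = irreducible-depressedCubic-root∉GF m irreducible root (frobenius-fixed⇒InGF m (sym r≈σr))

    σr≉σσr : ¬ σ r ≈ σ (σ r)
    σr≉σσr σr≈σσr = frobenius-injective m σr≈σσr r≉σr

    r≉σσr : ¬ r ≈ σ (σ r)
    r≉σσr r≈σσr = r≉σr (sym (begin
      σ r                     ≈⟨ frobenius-cong m r≈σσr ⟩
      σ (σ (σ r))             ≈⟨ frobenius-3* m r ⟨
      frobenius (3 ℕ.* m) r   ≈⟨ fixed ⟩
      r                       ∎))

  root-isPthPower⇒constant-isPthPower : ∀ m {a b r p} → IrreducibleOver K m (depressedCubic a b) →
    eval K (depressedCubic a b) r ≈ 0# → IsPthPowerIn K (3 ℕ.* m) p r → IsPthPowerIn K m p b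
  root-isPthPower⇒constant-isPthPower m {a} {b} {r} {p} irreducible root (y , y∈ , y≉0 , y^p≈r) =
    norm m y , frobenius-fixed⇒InGF m (norm-fixed m (InGF⇒frobenius-fixed (3 ℕ.* m) y∈)) , norm≉0 m y≉0 ,
    (begin
      pow K (norm m y) p      ≈⟨ pow≈^ (norm m y) p ⟩
      norm m y ^ p            ≈⟨ norm-^ m y p ⟨
      norm m (y ^ p)          ≈⟨ norm-cong m y^p≈r′ ⟩
      norm m r                ≈⟨ norm-of-root m irreducible root r-fixed ⟩
      b                       ∎)
    where
    y^p≈r′ : y ^ p ≈ r
    y^p≈r′ = trans (sym (pow≈^ y p)) y^p≈r

    r-fixed : frobenius (3 ℕ.* m) r ≈ r
    r-fixed = begin
      frobenius (3 ℕ.* m) r         ≈⟨ frobenius-cong (3 ℕ.* m) y^p≈r′ ⟨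
      frobenius (3 ℕ.* m) (y ^ p)   ≈⟨ frobenius-^ (3 ℕ.* m) y p ⟩
      frobenius (3 ℕ.* m) y ^ p     ≈⟨ ^-congˡ p (InGF⇒frobenius-fixed (3 ℕ.* m) y∈) ⟩
      y ^ p                         ≈⟨ y^p≈r′ ⟩
      r                             ∎

  -- On GF(2^(m′+1)) the 2^e-th power map is inverted by the 2^(e m′)-th power map.
  isPthPower-frobenius⇒¬¬isPthPower : ∀ {m} e p {x} → 1 ℕ.≤ m →
    IsPthPowerIn K m p (pow K x (2 ℕ.^ e)) → ¬ ¬ IsPthPowerIn K m p x
  isPthPower-frobenius⇒¬¬isPthPower {suc m′} e p {x} (s≤s _) (w , w∈ , w≉0 , w^p≈) ¬x-pth =
    frobenius-injective e v^p-lifts (λ v^p≈x →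
      ¬x-pth (v , frobenius-fixed⇒InGF (suc m′) v-fixed , x^n≉0 (2 ℕ.^ N) w≉0 , trans (pow≈^ v p) v^p≈x))
    where
    N : ℕ
    N = e ℕ.* m′

    v : Carrier
    v = frobenius N w

    w-fixed : frobenius (suc m′) w ≈ w
    w-fixed = InGF⇒frobenius-fixed (suc m′) w∈

    v-fixed : frobenius (suc m′) v ≈ v
    v-fixed = trans (frobenius-comm (suc m′) N w) (frobenius-cong N w-fixed)

    frobenius-e-v : frobenius e v ≈ w
    frobenius-e-v = begin
      frobenius e (frobenius N w)     ≈⟨ frobenius-+ℕ N e w ⟨
      frobenius (N ℕ.+ e) w           ≡⟨ ≡.cong (λ k → frobenius k w)
                                           (≡.trans (ℕ.+-comm N e) (≡.sym (ℕ.*-suc e m′))) ⟩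
      frobenius (e ℕ.* suc m′) w      ≈⟨ frobenius-fixed-iterate w-fixed e ⟩
      w                               ∎

    v^p-lifts : frobenius e (v ^ p) ≈ frobenius e x
    v^p-lifts = begin
      frobenius e (v ^ p)     ≈⟨ frobenius-^ e v p ⟩
      frobenius e v ^ p       ≈⟨ ^-congˡ p frobenius-e-v ⟩
      w ^ p                   ≈⟨ pow≈^ w p ⟨
      pow K w p               ≈⟨ w^p≈ ⟩
      pow K x (2 ℕ.^ e)       ≈⟨ pow≈^ x (2 ℕ.^ e) ⟩
      frobenius e x           ∎

  module _ (e : ℕ) (x : ℕ → Carrier) (tower : NormalTower K e x) (p : ℕ) where

    IsPthPowerInTower : ℕ → Set (c ⊔ ℓ)
    IsPthPowerInTower k = IsPthPowerIn K (2 ℕ.* 3 ℕ.^ k) p (x k)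

    not-pthPower-ascends : ∀ {k} → 1 ℕ.≤ k → ¬ IsPthPowerInTower k → ¬ IsPthPowerInTower (suc k)
    not-pthPower-ascends {k} 1≤k ¬xₖ-pth xₖ₊₁-pth =
      isPthPower-frobenius⇒¬¬isPthPower {2 ℕ.* 3 ℕ.^ k} e p 1≤2*3^k
        (root-isPthPower⇒constant-isPthPower (2 ℕ.* 3 ℕ.^ k) {p = p} irreducible root
          (≡.subst (λ i → IsPthPowerIn K i p (x (suc k))) (x∙yz≈y∙xz 2 3 (3 ℕ.^ k)) xₖ₊₁-pth))
        ¬xₖ-pth
      where
      irreducible : IrreducibleOver K (2 ℕ.* 3 ℕ.^ k) (fpoly K e (x k))
      irreducible = proj₁ (proj₂ tower (suc k) (s≤s 1≤k))

      root : eval K (fpoly K e (x k)) (x (suc k)) ≈ 0#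
      root = proj₂ (proj₂ tower (suc k) (s≤s 1≤k))

      1≤2*3^k : 1 ℕ.≤ 2 ℕ.* 3 ℕ.^ k
      1≤2*3^k = ℕ.≤-trans (ℕ.m^n>0 3 k) (ℕ.m≤m+n (3 ℕ.^ k) _)

    not-pthPower-propagates : ∀ {i j} → 1 ℕ.≤ i → i ≤′ j → ¬ IsPthPowerInTower i → ¬ IsPthPowerInTower j
    not-pthPower-propagates 1≤i ≤′-refl           = id
    not-pthPower-propagates 1≤i (≤′-step i≤′j) =
      not-pthPower-ascends (ℕ.≤-trans 1≤i (ℕ.≤′⇒≤ i≤′j)) ∘ not-pthPower-propagates 1≤i i≤′j

open import Data.Nat using (_∸_; _≤_; _<_; _^_; _*_)
open import Data.Nat.Primality using (Prime)
open import Data.Nat.Divisibility using (_∣_)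

proposition4p1 : ∀ {c ℓ : Level} (K : CommutativeRing c ℓ) →
    IsField K → Char2 K → AlgClosed K →
    (e : ℕ) (x : ℕ → CommutativeRing.Carrier K) → NormalTower K e x →
    (n : ℕ) → 1 < n →
    (p : ℕ) → Prime p → p ∣ (2 ^ (2 * 3 ^ (n ∸ 1)) ∸ 1) →
    ¬ IsPthPowerIn K (2 * 3 ^ (n ∸ 1)) p (x (n ∸ 1)) →
    (j : ℕ) → n ≤ j → ¬ IsPthPowerIn K (2 * 3 ^ j) p (x j)
proposition4p1 K isField char2 _ e x tower (suc n) (s≤s 1≤n) p _ _ ¬xₙ-pth j n<j =
  not-pthPower-propagates e x tower p 1≤n (ℕ.≤⇒≤′ (ℕ.<⇒≤ n<j)) ¬xₙ-pth
  where open CharacteristicTwoField K isField char2
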